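{- $\gamma(G)=3$ for every connected finite simple undirected graph $G$ containing a subgraph isomorphic to $P_5$. In particular, for each $n\ge 5$ there exist an infinite $P_n$-word and an infinite $C_n$-word which become square-free under some $3$-colouring.
   Context: For a graph $G$ on vertex set $A_n=\{0,\ldots,n-1\}$, a finite or infinite word over $A_n$ is a $G$-word if each consecutive pair of letters is an edge of $G$. A word is square-free if it has no factor $uu$ with $u$ nonempty. A $k$-colouring is a map $\varphi\colon A_n\to\{0,\ldots,k-1\}$ extended letterwise to words. $\gamma(G)$ is the smallest $k$ such that some infinite $G$-word $w$ and some $k$-colouring $\varphi$ have $\varphi(w)$ square-free. $P_m$ is the path on $\{0,\ldots,m-1\}$ with edges $i(i+1)$; $C_m$ is the cycle with edges $i(i+1)$ indices mod $m$. Subgraphs need not be induced. -}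

module Defs where

open import Data.Nat using (ℕ; zero; suc; _+_; _<_; _%_)
open import Data.Fin using (Fin; toℕ)
open import Data.Product using (Σ; _×_)
open import Data.Sum using (_⊎_)
open import Relation.Nullary using (¬_)
open import Relation.Binary.PropositionalEquality using (_≡_)
open import Relation.Binary.Construct.Closure.ReflexiveTransitive using (Star)
open import Function using (_∘_; Injective)

record Graph (n : ℕ) : Set₁ where
  field
    Adj     : Fin n → Fin n → Set
    sym     : ∀ {u v} → Adj u v → Adj v u
    irrefl  : ∀ {u} → ¬ Adj u u

open Graph public

Connected : ∀ {n} → Graph n → Set
Connected {n} G = (u v : Fin n) → Star (Adj G) u v

ContainsP5 : ∀ {n} → Graph n → Set
ContainsP5 {n} G =
  Σ (Fin 5 → Fin n) λ f →
    Injective _≡_ _≡_ f ×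
    ((i j : Fin 5) → suc (toℕ i) ≡ toℕ j → Adj G (f i) (f j))

IsWord : ∀ {n} → (Fin n → Fin n → Set) → (ℕ → Fin n) → Set
IsWord E w = (i : ℕ) → E (w i) (w (suc i))

SquareFree : {A : Set} → (ℕ → A) → Set
SquareFree w = (i l : ℕ) → 0 < l → ¬ ((j : ℕ) → j < l → w (i + j) ≡ w (i + l + j))

Colourable : ∀ {n} → (Fin n → Fin n → Set) → ℕ → Set
Colourable {n} E k =
  Σ (ℕ → Fin n) λ w → IsWord E w ×
    Σ (Fin n → Fin k) λ φ → SquareFree (φ ∘ w)

GammaIs : ∀ {n} → Graph n → ℕ → Set
GammaIs G k = Colourable (Adj G) k × ((m : ℕ) → m < k → ¬ Colourable (Adj G) m)

PathAdj : (m : ℕ) → Fin m → Fin m → Set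
PathAdj m i j = (suc (toℕ i) ≡ toℕ j) ⊎ (suc (toℕ j) ≡ toℕ i)

CycleAdj : (m : ℕ) → Fin m → Fin m → Set
CycleAdj zero i j = PathAdj zero i j
CycleAdj (suc m) i j = (suc (toℕ i) % suc m ≡ toℕ j) ⊎ (suc (toℕ j) % suc m ≡ toℕ i)

-- The Thue–Morse word t (t 2k = t k, t (2k+1) = ¬ t k) is overlap-free: an overlap of odd
-- period contradicts t (4q+1) = t (4q+2) against t 2k ≠ t (2k+1), and one of even period halves.
-- Hence its difference sequence t (n+1) − t n is a square-free word over three letters. That word
-- is the colouring of a walk on P₅ coloured 0,2,1,0,2: the walk alternates between the sides
-- {1,3} and {0,2,4}, each of which carries every colour it needs, and t 2k ≠ t (2k+1) keeps it on
-- edges. A copy of P₅ in G transports the walk, and over at most two letters every word of length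
-- four contains a square.
module Submission where

open import Defs renaming (sym to Adj-sym)
open import Data.Bool using (Bool; true; false; not)
import Data.Bool.Properties as Bool
open import Data.Fin using (Fin; zero; suc; toℕ; inject≤; #_)
import Data.Fin.Properties as Fin
open import Data.List using (_∷_; [])
open import Data.Nat using (ℕ; zero; suc; _+_; _*_; _≤_; _<_; _%_; z≤n; s≤s; parity)
open import Data.Nat.DivMod using (m<n⇒m%n≡m)
open import Data.Nat.Induction using (<-wellFounded)
open import Data.Nat.Properties
  using (+-suc; +-comm; +-identityʳ; *-suc; *-assoc; *-distribˡ-+; ≤-refl; ≤-trans; n≤1+n; <⇒≤; *-monoʳ-≤; m<m+n)
open import Data.Nat.Tactic.RingSolver using (solve)
import Data.Nat.Binary.Base as ℕᵇ
import Data.Nat.Binary.Properties as ℕᵇ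
open import Data.Parity.Base using (Parity; 0ℙ; 1ℙ; _⁻¹)
import Data.Parity.Base as ℙ
open import Data.Parity.Properties using (⁻¹-selfInverse; suc-homo-⁻¹; +-homo-+; *-homo-*)
open import Data.Product using (_×_; _,_; proj₁; proj₂)
import Data.Product as Product
open import Data.Sum using (inj₁; inj₂)
open import Function using (_∘_; Injective)
open import Induction.WellFounded using (Acc; acc)
open import Relation.Nullary using (¬_; yes; no; contradiction)
open import Relation.Binary.PropositionalEquality

data EvenOdd : ℕ → Set where
  even : ∀ k → EvenOdd (2 * k)
  odd  : ∀ k → EvenOdd (1 + 2 * k)

parityView : ∀ n → EvenOdd n
parityView zero = even 0
parityView (suc n) with parityView n
... | even k = odd k
... | odd k = subst EvenOdd (*-suc 2 k) (even (suc k))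

data Mod4 : ℕ → Set where
  rem0 : ∀ q → Mod4 (4 * q)
  rem1 : ∀ q → Mod4 (1 + 4 * q)
  rem2 : ∀ q → Mod4 (2 + 4 * q)
  rem3 : ∀ q → Mod4 (3 + 4 * q)

mod4View : ∀ n → Mod4 n
mod4View n with parityView n
... | even k with parityView k
...   | even q = subst Mod4 {4 * q} (solve (q ∷ [])) (rem0 q)
...   | odd q  = subst Mod4 {2 + 4 * q} (solve (q ∷ [])) (rem2 q)
mod4View n | odd k with parityView k
...   | even q = subst Mod4 {1 + 4 * q} (solve (q ∷ [])) (rem1 q)
...   | odd q  = subst Mod4 {3 + 4 * q} (solve (q ∷ [])) (rem3 q)

parity-suc : ∀ n → parity (suc n) ≡ parity n ⁻¹
parity-suc n = sym (⁻¹-selfInverse (suc-homo-⁻¹ n))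

parity-1+2* : ∀ k → parity (1 + 2 * k) ≡ 1ℙ
parity-1+2* k = trans (+-homo-+ 1 (2 * k)) (cong (1ℙ ℙ.+_) (*-homo-* 2 k))

-- thueMorsePair x = (t x , t (1 + x)); carrying the successor makes the recursion structural.
thueMorsePair : ℕᵇ.ℕᵇ → Bool × Bool
thueMorsePair ℕᵇ.zero     = false , true
thueMorsePair ℕᵇ.2[1+ x ] = proj₂ (thueMorsePair x) , not (proj₂ (thueMorsePair x))
thueMorsePair ℕᵇ.1+[2 x ] = not (proj₁ (thueMorsePair x)) , proj₂ (thueMorsePair x)

thueMorse : ℕ → Bool
thueMorse n = proj₁ (thueMorsePair (ℕᵇ.fromℕ' n))

thueMorsePair-suc : ∀ x → proj₂ (thueMorsePair x) ≡ proj₁ (thueMorsePair (ℕᵇ.suc x))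
thueMorsePair-suc ℕᵇ.zero     = refl
thueMorsePair-suc ℕᵇ.2[1+ x ] = cong not (thueMorsePair-suc x)
thueMorsePair-suc ℕᵇ.1+[2 x ] = refl

fromℕ'-1+2* : ∀ k → ℕᵇ.fromℕ' (1 + 2 * k) ≡ ℕᵇ.1+[2 ℕᵇ.fromℕ' k ]
fromℕ'-1+2* k = ℕᵇ.toℕ-injective (begin
  ℕᵇ.toℕ (ℕᵇ.fromℕ' (1 + 2 * k)) ≡⟨ ℕᵇ.toℕ-fromℕ' (1 + 2 * k) ⟩
  1 + 2 * k                      ≡⟨ cong (λ m → 1 + 2 * m) (sym (ℕᵇ.toℕ-fromℕ' k)) ⟩
  ℕᵇ.toℕ ℕᵇ.1+[2 ℕᵇ.fromℕ' k ]   ∎)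
  where open ≡-Reasoning

fromℕ'-2*suc : ∀ k → ℕᵇ.fromℕ' (2 * suc k) ≡ ℕᵇ.2[1+ ℕᵇ.fromℕ' k ]
fromℕ'-2*suc k = ℕᵇ.toℕ-injective (begin
  ℕᵇ.toℕ (ℕᵇ.fromℕ' (2 * suc k)) ≡⟨ ℕᵇ.toℕ-fromℕ' (2 * suc k) ⟩
  2 * suc k                      ≡⟨ cong (λ m → 2 * suc m) (sym (ℕᵇ.toℕ-fromℕ' k)) ⟩
  ℕᵇ.toℕ ℕᵇ.2[1+ ℕᵇ.fromℕ' k ]   ∎)
  where open ≡-Reasoning

thueMorse-2* : ∀ k → thueMorse (2 * k) ≡ thueMorse k
thueMorse-2* zero    = refl
thueMorse-2* (suc k) =
  trans (cong (proj₁ ∘ thueMorsePair) (fromℕ'-2*suc k)) (thueMorsePair-suc (ℕᵇ.fromℕ' k))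

thueMorse-1+2* : ∀ k → thueMorse (1 + 2 * k) ≡ not (thueMorse k)
thueMorse-1+2* k = cong (proj₁ ∘ thueMorsePair) (fromℕ'-1+2* k)

thueMorse-2*≢1+2* : ∀ k → thueMorse (2 * k) ≢ thueMorse (1 + 2 * k)
thueMorse-2*≢1+2* k e = Bool.not-¬ refl (begin
  thueMorse k             ≡⟨ sym (thueMorse-2* k) ⟩
  thueMorse (2 * k)       ≡⟨ e ⟩
  thueMorse (1 + 2 * k)   ≡⟨ thueMorse-1+2* k ⟩
  not (thueMorse k)       ∎)
  where open ≡-Reasoning

thueMorse-even⇒≢suc : ∀ n → parity n ≡ 0ℙ → thueMorse n ≢ thueMorse (suc n)
thueMorse-even⇒≢suc n p≡0 with parityView n
... | even k = thueMorse-2*≢1+2* k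
... | odd k  = contradiction (trans (sym (parity-1+2* k)) p≡0) λ ()

thueMorse-1+4*≡2+4* : ∀ q → thueMorse (1 + 4 * q) ≡ thueMorse (2 + 4 * q)
thueMorse-1+4*≡2+4* q = begin
  thueMorse (1 + 4 * q)         ≡⟨ cong (λ m → thueMorse (1 + m)) (*-assoc 2 2 q) ⟩
  thueMorse (1 + 2 * (2 * q))   ≡⟨ thueMorse-1+2* (2 * q) ⟩
  not (thueMorse (2 * q))       ≡⟨ cong not (thueMorse-2* q) ⟩
  not (thueMorse q)             ≡⟨ sym (thueMorse-1+2* q) ⟩
  thueMorse (1 + 2 * q)         ≡⟨ sym (thueMorse-2* (1 + 2 * q)) ⟩
  thueMorse (2 * (1 + 2 * q))   ≡⟨ cong thueMorse (*-suc 2 (2 * q)) ⟩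
  thueMorse (2 + 2 * (2 * q))   ≡⟨ cong (λ m → thueMorse (2 + m)) (*-assoc 2 2 q) ⟨
  thueMorse (2 + 4 * q)         ∎
  where open ≡-Reasoning

thueMorse-pairs-differ : ∀ q k →
  ¬ (thueMorse (1 + 4 * q) ≡ thueMorse (2 * k) × thueMorse (2 + 4 * q) ≡ thueMorse (1 + 2 * k))
thueMorse-pairs-differ q k (e , e′) =
  thueMorse-2*≢1+2* k (trans (sym e) (trans (thueMorse-1+4*≡2+4* q) e′))

-- x (i) … x (i + 2l) has period l: an overlap a v a v a with a a single letter and |a v| = l.
record Overlap {A : Set} (x : ℕ → A) (i l : ℕ) : Set where
  constructor overlapping
  field agree : ∀ j → j ≤ l → x (i + j) ≡ x (i + l + j)

module _ {A : Set} {x : ℕ → A} {i l : ℕ} (ov : Overlap x i l) where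

  overlap-at : ∀ j p p′ → j ≤ l → i + j ≡ p → i + l + j ≡ p′ → x p ≡ x p′
  overlap-at j _ _ j≤l refl refl = Overlap.agree ov j j≤l

  overlap-pair : ∀ j p p′ → j < l → i + j ≡ p → i + l + j ≡ p′ →
                 x p ≡ x p′ × x (suc p) ≡ x (suc p′)
  overlap-pair j p p′ j<l e e′ =
    overlap-at j p p′ (<⇒≤ j<l) e e′ ,
    overlap-at (suc j) (suc p) (suc p′) j<l
      (trans (+-suc i j) (cong suc e)) (trans (+-suc (i + l) j) (cong suc e′))

thueMorse-no-overlap-1 : ∀ i → ¬ Overlap thueMorse i 1
thueMorse-no-overlap-1 i o with parityView i
... | even k = thueMorse-2*≢1+2* k
                 (overlap-at o 0 (2 * k) (1 + 2 * k) z≤n (+-identityʳ _) (solve (k ∷ [])))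
... | odd k  = thueMorse-2*≢1+2* (suc k)
                 (overlap-at o 1 (2 * suc k) (1 + 2 * suc k) ≤-refl (solve (k ∷ [])) (solve (k ∷ [])))

-- Some j < l puts a position 4q+1 of one copy of the overlap against a position 2k of the other.
thueMorse-no-odd-overlap : ∀ i s → ¬ Overlap thueMorse i (3 + 2 * s)
thueMorse-no-odd-overlap i s o with mod4View i
... | rem0 q = thueMorse-pairs-differ q (2 + 2 * q + s)
      (overlap-pair o 1 (1 + 4 * q) (2 * (2 + 2 * q + s)) (s≤s (s≤s z≤n))
        (solve (q ∷ [])) (solve (q ∷ s ∷ [])))
... | rem1 q = thueMorse-pairs-differ q (2 + 2 * q + s)
      (overlap-pair o 0 (1 + 4 * q) (2 * (2 + 2 * q + s)) (s≤s z≤n)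
        (solve (q ∷ [])) (solve (q ∷ s ∷ [])))
... | rem3 q = thueMorse-pairs-differ (1 + q) (4 + 2 * q + s)
      (overlap-pair o 2 (1 + 4 * (1 + q)) (2 * (4 + 2 * q + s)) (s≤s (s≤s (s≤s z≤n)))
        (solve (q ∷ [])) (solve (q ∷ s ∷ [])))
... | rem2 q with parityView s
...   | even u = thueMorse-pairs-differ (1 + q + u) (1 + 2 * q) (Product.map sym sym
      (overlap-pair o 0 (2 * (1 + 2 * q)) (1 + 4 * (1 + q + u)) (s≤s z≤n)
        (solve (q ∷ [])) (solve (q ∷ u ∷ []))))
...   | odd u  = thueMorse-pairs-differ (2 + q + u) (2 + 2 * q) (Product.map sym sym
      (overlap-pair o 2 (2 * (2 + 2 * q)) (1 + 4 * (2 + q + u)) (s≤s (s≤s (s≤s z≤n)))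
        (solve (q ∷ [])) (solve (q ∷ u ∷ []))))

thueMorse-overlap-halve : ∀ a m → Overlap thueMorse (2 * a) (2 * m) → Overlap thueMorse a m
thueMorse-overlap-halve a m o = overlapping λ j j≤m → begin
  thueMorse (a + j)             ≡⟨ thueMorse-2* (a + j) ⟨
  thueMorse (2 * (a + j))       ≡⟨ overlap-at o (2 * j) (2 * (a + j)) (2 * (a + m + j))
                                     (*-monoʳ-≤ 2 j≤m) (solve (a ∷ j ∷ [])) (solve (a ∷ m ∷ j ∷ [])) ⟩
  thueMorse (2 * (a + m + j))   ≡⟨ thueMorse-2* (a + m + j) ⟩
  thueMorse (a + m + j)         ∎
  where open ≡-Reasoning

-- Works because t (2a) = ¬ t (2a + 1).
thueMorse-overlap-extendˡ : ∀ a m → Overlap thueMorse (1 + 2 * a) (2 * m) →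
                            Overlap thueMorse (2 * a) (2 * m)
thueMorse-overlap-extendˡ a m o = overlapping agree
  where
  open ≡-Reasoning

  shifted : not (thueMorse a) ≡ not (thueMorse (a + m))
  shifted = begin
    not (thueMorse a)               ≡⟨ thueMorse-1+2* a ⟨
    thueMorse (1 + 2 * a)           ≡⟨ overlap-at o 0 (1 + 2 * a) (1 + 2 * (a + m)) z≤n
                                         (+-identityʳ _) (solve (a ∷ m ∷ [])) ⟩
    thueMorse (1 + 2 * (a + m))     ≡⟨ thueMorse-1+2* (a + m) ⟩
    not (thueMorse (a + m))         ∎

  agree : ∀ j → j ≤ 2 * m → thueMorse (2 * a + j) ≡ thueMorse (2 * a + 2 * m + j)
  agree zero _ = begin
    thueMorse (2 * a + 0)           ≡⟨ cong thueMorse (+-identityʳ (2 * a)) ⟩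
    thueMorse (2 * a)               ≡⟨ thueMorse-2* a ⟩
    thueMorse a                     ≡⟨ Bool.not-injective shifted ⟩
    thueMorse (a + m)               ≡⟨ thueMorse-2* (a + m) ⟨
    thueMorse (2 * (a + m))         ≡⟨ cong thueMorse (trans (*-distribˡ-+ 2 a m) (sym (+-identityʳ _))) ⟩
    thueMorse (2 * a + 2 * m + 0)   ∎
  agree (suc j) 1+j≤2m = overlap-at o j (2 * a + suc j) (2 * a + 2 * m + suc j)
    (≤-trans (n≤1+n j) 1+j≤2m) (solve (a ∷ j ∷ [])) (solve (a ∷ m ∷ j ∷ []))

thueMorse-overlapFree : ∀ i l → 0 < l → ¬ Overlap thueMorse i l
thueMorse-overlapFree i l = go (<-wellFounded l) i
  where
  go : ∀ {l} → Acc _<_ l → ∀ i → 0 < l → ¬ Overlap thueMorse i l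
  go {l} (acc smaller) i 0<l o with parityView l
  ... | odd zero    = thueMorse-no-overlap-1 i o
  ... | odd (suc s) = thueMorse-no-odd-overlap i s (subst (Overlap thueMorse i) (cong suc (*-suc 2 s)) o)
  ... | even zero   = contradiction 0<l λ ()
  ... | even (suc m) with parityView i
  ...   | even a = go (smaller (m<m+n (suc m) (s≤s z≤n))) a (s≤s z≤n)
                     (thueMorse-overlap-halve a (suc m) o)
  ...   | odd a  = go (smaller (m<m+n (suc m) (s≤s z≤n))) a (s≤s z≤n)
                     (thueMorse-overlap-halve a (suc m) (thueMorse-overlap-extendˡ a (suc m) o))

-- difference a b encodes b − a ∈ {−1, 0, 1} as 1 + b − a.
difference : Bool → Bool → Fin 3
difference false false = # 1
difference false true  = # 2
difference true  false = # 0
difference true  true  = # 1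

differences : (ℕ → Bool) → ℕ → Fin 3
differences x n = difference (x n) (x (suc n))

difference-injectiveʳ : ∀ a {b c} → difference a b ≡ difference a c → b ≡ c
difference-injectiveʳ false {false} {false} _ = refl
difference-injectiveʳ false {true}  {true}  _ = refl
difference-injectiveʳ true  {false} {false} _ = refl
difference-injectiveʳ true  {true}  {true}  _ = refl

difference-not : ∀ a {b c} → difference a b ≡ difference (not a) c → b ≡ a × c ≡ not b
difference-not false {false} {true}  _  = refl , refl
difference-not true  {true}  {false} _  = refl , refl
difference-not false {false} {false} ()
difference-not false {true}  {false} ()
difference-not false {true}  {true}  ()
difference-not true  {false} {false} ()
difference-not true  {false} {true}  ()
difference-not true  {true}  {true}  ()

-- The differences agree along the square, so the two halves of x differ by a constant;
-- a nonzero constant would force x to be constant on the first half, making it zero after all.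
module _ (x : ℕ → Bool) {i l : ℕ}
         (square : ∀ j → j < l → differences x (i + j) ≡ differences x (i + l + j)) where

  square-equal-start : x (i + 0) ≡ x (i + l + 0) → Overlap x i l
  square-equal-start e = overlapping agree
    where
    agree : ∀ j → j ≤ l → x (i + j) ≡ x (i + l + j)
    agree zero    _   = e
    agree (suc j) j<l = subst₂ (λ p p′ → x p ≡ x p′) (sym (+-suc i j)) (sym (+-suc (i + l) j))
      (difference-injectiveʳ (x (i + l + j))
        (trans (cong (λ b → difference b (x (suc (i + j)))) (sym (agree j (<⇒≤ j<l)))) (square j j<l)))

  square-flipped-start : x (i + l + 0) ≡ not (x (i + 0)) →
                         ∀ j → j ≤ l → x (i + j) ≡ x (i + 0) × x (i + l + j) ≡ not (x (i + j))
  square-flipped-start e zero    _   = refl , e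
  square-flipped-start e (suc j) j<l =
    let (same , flipped) = square-flipped-start e j (<⇒≤ j<l)
        (same′ , flipped′) = difference-not (x (i + j))
          (trans (square j j<l) (cong (λ b → difference b (x (suc (i + l + j)))) flipped))
    in trans (cong x (+-suc i j)) (trans same′ same) ,
       trans (cong x (+-suc (i + l) j)) (trans flipped′ (cong (not ∘ x) (sym (+-suc i j))))

  differences-square⇒overlap : Overlap x i l
  differences-square⇒overlap with x (i + 0) Bool.≟ x (i + l + 0)
  ... | yes same = square-equal-start same
  ... | no differ = contradiction (trans (cong x (sym (+-identityʳ (i + l)))) flipped) (Bool.not-¬ same)
    where
    flipped : x (i + l + 0) ≡ not (x (i + 0))
    flipped = Bool.¬-not (differ ∘ sym)
    same : x (i + l) ≡ x (i + 0)
    same = proj₁ (square-flipped-start flipped l ≤-refl)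

SquareFree-resp : ∀ {A : Set} {u v : ℕ → A} → (∀ n → u n ≡ v n) → SquareFree u → SquareFree v
SquareFree-resp u≗v sf i l 0<l square =
  sf i l 0<l λ j j<l → trans (u≗v (i + j)) (trans (square j j<l) (sym (u≗v (i + l + j))))

differences-thueMorse-squareFree : SquareFree (differences thueMorse)
differences-thueMorse-squareFree i l 0<l square =
  thueMorse-overlapFree i l 0<l (differences-square⇒overlap thueMorse square)

p5Colouring : Fin 5 → Fin 3
p5Colouring zero                         = # 0
p5Colouring (suc zero)                   = # 2
p5Colouring (suc (suc zero))             = # 1
p5Colouring (suc (suc (suc zero)))       = # 0
p5Colouring (suc (suc (suc (suc zero)))) = # 2

-- liftVertex p a b is a vertex of colour difference a b, on the side {1,3} when p = 0ℙ and on
-- {0,2,4} when p = 1ℙ. At even positions a ≢ b, and the value for a ≡ b is junk.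
liftVertex : Parity → Bool → Bool → Fin 5
liftVertex 0ℙ false true  = # 1
liftVertex 0ℙ true  false = # 3
liftVertex 0ℙ _     _     = # 2
liftVertex 1ℙ false true  = # 4
liftVertex 1ℙ true  false = # 0
liftVertex 1ℙ _     _     = # 2

liftVertex-colour : ∀ p a b → (p ≡ 0ℙ → a ≢ b) → p5Colouring (liftVertex p a b) ≡ difference a b
liftVertex-colour 0ℙ false true  _ = refl
liftVertex-colour 0ℙ true  false _ = refl
liftVertex-colour 0ℙ false false h = contradiction refl (h refl)
liftVertex-colour 0ℙ true  true  h = contradiction refl (h refl)
liftVertex-colour 1ℙ false false _ = refl
liftVertex-colour 1ℙ false true  _ = refl
liftVertex-colour 1ℙ true  false _ = refl
liftVertex-colour 1ℙ true  true  _ = refl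

liftVertex-adjacent : ∀ p a b c → (p ≡ 0ℙ → a ≢ b) → (p ≡ 1ℙ → b ≢ c) →
                      PathAdj 5 (liftVertex p a b) (liftVertex (p ⁻¹) b c)
liftVertex-adjacent 0ℙ false true  false _ _ = inj₂ refl
liftVertex-adjacent 0ℙ false true  true  _ _ = inj₁ refl
liftVertex-adjacent 0ℙ true  false false _ _ = inj₂ refl
liftVertex-adjacent 0ℙ true  false true  _ _ = inj₁ refl
liftVertex-adjacent 0ℙ false false _     h _ = contradiction refl (h refl)
liftVertex-adjacent 0ℙ true  true  _     h _ = contradiction refl (h refl)
liftVertex-adjacent 1ℙ false false true  _ _ = inj₂ refl
liftVertex-adjacent 1ℙ false true  false _ _ = inj₂ refl
liftVertex-adjacent 1ℙ true  false true  _ _ = inj₁ refl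
liftVertex-adjacent 1ℙ true  true  false _ _ = inj₁ refl
liftVertex-adjacent 1ℙ _     false false _ h = contradiction refl (h refl)
liftVertex-adjacent 1ℙ _     true  true  _ h = contradiction refl (h refl)

module _ (x : ℕ → Bool) (even-step : ∀ n → parity n ≡ 0ℙ → x n ≢ x (suc n)) where

  liftWalk : ℕ → Fin 5
  liftWalk n = liftVertex (parity n) (x n) (x (suc n))

  liftWalk-isWord : IsWord (PathAdj 5) liftWalk
  liftWalk-isWord n =
    subst (λ p → PathAdj 5 (liftWalk n) (liftVertex p (x (suc n)) (x (suc (suc n)))))
          (sym (parity-suc n))
          (liftVertex-adjacent (parity n) (x n) (x (suc n)) (x (suc (suc n)))
            (even-step n) (λ odd → even-step (suc n) (trans (parity-suc n) (cong _⁻¹ odd))))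

  liftWalk-colour : ∀ n → p5Colouring (liftWalk n) ≡ differences x n
  liftWalk-colour n = liftVertex-colour (parity n) (x n) (x (suc n)) (even-step n)

P₅-colourable : Colourable (PathAdj 5) 3
P₅-colourable =
  liftWalk thueMorse thueMorse-even⇒≢suc ,
  liftWalk-isWord thueMorse thueMorse-even⇒≢suc ,
  p5Colouring ,
  SquareFree-resp (λ n → sym (liftWalk-colour thueMorse thueMorse-even⇒≢suc n))
    differences-thueMorse-squareFree

extendAlong : ∀ {m n} {A : Set} → (Fin m → Fin n) → (Fin m → A) → A → Fin n → A
extendAlong {zero}  g h default y = default
extendAlong {suc m} g h default y with g zero Fin.≟ y
... | yes _ = h zero
... | no _  = extendAlong (g ∘ suc) (h ∘ suc) default y

extendAlong-∘ : ∀ {m n} {A : Set} (g : Fin m → Fin n) (h : Fin m → A) default →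
                Injective _≡_ _≡_ g → ∀ a → extendAlong g h default (g a) ≡ h a
extendAlong-∘ g h default g-inj zero with g zero Fin.≟ g zero
... | yes _  = refl
... | no g0≢ = contradiction refl g0≢
extendAlong-∘ g h default g-inj (suc a) with g zero Fin.≟ g (suc a)
... | yes g0≡ = contradiction (g-inj g0≡) λ ()
... | no _    = extendAlong-∘ (g ∘ suc) (h ∘ suc) default (Fin.suc-injective ∘ g-inj) a

Colourable-transport : ∀ {m n k} {E : Fin m → Fin m → Set} (E′ : Fin n → Fin n → Set)
                       (g : Fin m → Fin n) → Injective _≡_ _≡_ g → (∀ {a b} → E a b → E′ (g a) (g b)) →
                       Colourable E k → Colourable E′ k
Colourable-transport E′ g g-inj g-hom (w , w-isWord , φ , φw-squareFree) =
  g ∘ w , g-hom ∘ w-isWord , extendAlong g φ (φ (w 0)) ,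
  SquareFree-resp (λ n → sym (extendAlong-∘ g φ (φ (w 0)) g-inj (w n))) φw-squareFree

squareFree⇒≢suc : ∀ {A : Set} (u : ℕ → A) → SquareFree u → ∀ i → u i ≢ u (suc i)
squareFree⇒≢suc u sf i e = sf i 1 (s≤s z≤n) λ where
  zero    _        → subst₂ (λ p p′ → u p ≡ u p′) (sym (+-identityʳ i))
                       (sym (trans (+-identityʳ (i + 1)) (+-comm i 1))) e
  (suc j) (s≤s ())

squareFree⇒¬abab : ∀ {A : Set} (u : ℕ → A) → SquareFree u → u 0 ≡ u 2 → u 1 ≢ u 3
squareFree⇒¬abab u sf e₀ e₁ = sf 0 2 (s≤s z≤n) λ where
  zero          _              → e₀
  (suc zero)    _              → e₁
  (suc (suc j)) (s≤s (s≤s ()))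

≢-≢⇒≡-<3 : ∀ {k} → k < 3 → {a b c : Fin k} → a ≢ b → b ≢ c → a ≡ c
≢-≢⇒≡-<3 {1} _ {zero} {_} {zero} _ _ = refl
≢-≢⇒≡-<3 {2} _ {zero}     {zero}            a≢b _   = contradiction refl a≢b
≢-≢⇒≡-<3 {2} _ {zero}     {suc zero} {zero}     _ _   = refl
≢-≢⇒≡-<3 {2} _ {zero}     {suc zero} {suc zero} _ b≢c = contradiction refl b≢c
≢-≢⇒≡-<3 {2} _ {suc zero} {zero}     {zero}     _ b≢c = contradiction refl b≢c
≢-≢⇒≡-<3 {2} _ {suc zero} {zero}     {suc zero} _ _   = refl
≢-≢⇒≡-<3 {2} _ {suc zero} {suc zero}            a≢b _ = contradiction refl a≢b
≢-≢⇒≡-<3 {suc (suc (suc _))} (s≤s (s≤s (s≤s ())))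

¬squareFree-<3 : ∀ {k} → k < 3 → (u : ℕ → Fin k) → ¬ SquareFree u
¬squareFree-<3 k<3 u sf =
  squareFree⇒¬abab u sf (≢-≢⇒≡-<3 k<3 (≢suc 0) (≢suc 1)) (≢-≢⇒≡-<3 k<3 (≢suc 1) (≢suc 2))
  where
  ≢suc : ∀ i → u i ≢ u (suc i)
  ≢suc = squareFree⇒≢suc u sf

¬Colourable-<3 : ∀ {n} (E : Fin n → Fin n → Set) k → k < 3 → ¬ Colourable E k
¬Colourable-<3 E k k<3 (w , _ , φ , sf) = ¬squareFree-<3 k<3 (φ ∘ w) sf

inject≤-suc : ∀ {m n} (m≤n : m ≤ n) {a b : Fin m} →
              suc (toℕ a) ≡ toℕ b → suc (toℕ (inject≤ a m≤n)) ≡ toℕ (inject≤ b m≤n)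
inject≤-suc m≤n {a} {b} e =
  trans (cong suc (Fin.toℕ-inject≤ a m≤n)) (trans e (sym (Fin.toℕ-inject≤ b m≤n)))

inject≤-pathAdj : ∀ {m n} (m≤n : m ≤ n) {a b} → PathAdj m a b →
                  PathAdj n (inject≤ a m≤n) (inject≤ b m≤n)
inject≤-pathAdj m≤n (inj₁ e) = inj₁ (inject≤-suc m≤n e)
inject≤-pathAdj m≤n (inj₂ e) = inj₂ (inject≤-suc m≤n e)

inject≤-suc-mod : ∀ {m n} (m≤n : m ≤ suc n) {a b : Fin m} → suc (toℕ a) ≡ toℕ b →
                  suc (toℕ (inject≤ a m≤n)) % suc n ≡ toℕ (inject≤ b m≤n)
inject≤-suc-mod {n = n} m≤n {a} {b} e = trans (m<n⇒m%n≡m no-wrap) (inject≤-suc m≤n e)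
  where
  no-wrap : suc (toℕ (inject≤ a m≤n)) < suc n
  no-wrap = subst (_< suc n) (sym (inject≤-suc m≤n e)) (Fin.toℕ<n (inject≤ b m≤n))

inject≤-cycleAdj : ∀ {m n} (m≤n : m ≤ n) {a b} → PathAdj m a b →
                   CycleAdj n (inject≤ a m≤n) (inject≤ b m≤n)
inject≤-cycleAdj {n = zero}  z≤n {()}
inject≤-cycleAdj {n = suc n} m≤n (inj₁ e) = inj₁ (inject≤-suc-mod m≤n e)
inject≤-cycleAdj {n = suc n} m≤n (inj₂ e) = inj₂ (inject≤-suc-mod m≤n e)

ContainsP5⇒γ≡3 : ∀ {n} (G : Graph n) → ContainsP5 G → GammaIs G 3
ContainsP5⇒γ≡3 G (g , g-inj , g-edges) =
  Colourable-transport (Adj G) g g-inj g-hom P₅-colourable , λ k → ¬Colourable-<3 (Adj G) k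
  where
  g-hom : ∀ {a b} → PathAdj 5 a b → Adj G (g a) (g b)
  g-hom (inj₁ e) = g-edges _ _ e
  g-hom (inj₂ e) = Adj-sym G (g-edges _ _ e)

inject≤-Colourable : ∀ {n} (E : Fin n → Fin n → Set) (5≤n : 5 ≤ n) →
                     (∀ {a b} → PathAdj 5 a b → E (inject≤ a 5≤n) (inject≤ b 5≤n)) → Colourable E 3
inject≤-Colourable E 5≤n hom =
  Colourable-transport E (λ a → inject≤ a 5≤n) (λ {a} {b} → Fin.inject≤-injective 5≤n 5≤n a b) hom
    P₅-colourable

corollary7 : ((n : ℕ) (G : Graph n) → Connected G → ContainsP5 G → GammaIs G 3)
    × ((n : ℕ) → 5 ≤ n → Colourable (PathAdj n) 3 × Colourable (CycleAdj n) 3)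
corollary7 =
  (λ n G _ → ContainsP5⇒γ≡3 G) ,
  λ n 5≤n → inject≤-Colourable (PathAdj n) 5≤n (inject≤-pathAdj 5≤n) ,
            inject≤-Colourable (CycleAdj n) 5≤n (inject≤-cycleAdj 5≤n)
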